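{- Let $n\geq 3$ and let $1,2,\ldots,s_{\delta(n)},s_{\delta(n)+1}=n$ be an addition chain producing $n$ of length $\delta(n)$, with associated generators $2=a_2+r_2$, $s_3=a_3+r_3,\ldots,s_{\delta(n)+1}=a_{\delta(n)+1}+r_{\delta(n)+1}=n$, where $a_2=r_2=1$ and $a_{i+1}=a_i+r_i$ for $2\leq i\leq \delta(n)$. Then \[\sum_{j=2}^{\delta(n)+1} a_j=(n-1)+(\delta(n)-1)+a_{\delta(n)}-r_{\delta(n)+1}+\int_{2}^{\delta(n)-1}\sum_{2\leq j\leq t} r_j\,dt.\]
   Context: An addition chain of length $k-1$ producing $n$ is a sequence $1=s_1,2=s_2,\ldots,s_{k-1},s_k=n$ in which each term $s_j$ ($j\geq 3$) is the sum of two earlier terms. In this paper each term is written via a partition $s_i=a_i+r_i$ ($2\leq i\leq k$), called the $i$-th generator, with $2=1+1$ (i.e. $a_2=r_2=1$) and $a_{i+1}=a_i+r_i$; $a_i$ is the determiner and $r_i$ the regulator of the $i$-th generator. Here $k-1=\delta(n)$. The integrand $t\mapsto\sum_{2\leq j\leq t}r_j$ is the step function of the real variable $t$ summing the regulators with integer index $j$ satisfying $2\leq j\leq t$. -}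

module Defs where

open import Data.Nat using (ℕ; zero; suc; _+_; _∸_; _≤_; _<_; _≤ᵇ_)
open import Data.Integer using (ℤ; +_; -_) renaming (_+_ to _+ℤ_)
open import Data.Bool using (if_then_else_)
open import Data.Product using (∃₂; _×_)
open import Relation.Binary.PropositionalEquality using (_≡_)

sumN : (ℕ → ℤ) → ℕ → ℕ → ℤ
sumN f a zero    = + 0
sumN f a (suc l) = f a +ℤ sumN f (suc a) l

-- Σ_{j=a}^{b} f j  (empty, i.e. 0, when b < a)
sumFT : (ℕ → ℤ) → ℕ → ℕ → ℤ
sumFT f a b = sumN f a (suc b ∸ a)

-- The step function t ↦ Σ_{2 ≤ j ≤ t} r_j, evaluated at an integer t;
-- it is constant on every interval [m, m+1).
stepSum : (ℕ → ℕ) → ℕ → ℤ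
stepSum r t = sumFT (λ j → + r j) 2 t

-- Oriented integral ∫_a^b F(t) dt of a step function F that is constant on
-- every interval [m, m+1) (m ∈ ℕ), with integer endpoints a, b:
--   a ≤ b :  Σ_{m=a}^{b-1} F(m)
--   b < a :  - Σ_{m=b}^{a-1} F(m)
stepIntegral : (ℕ → ℤ) → ℕ → ℕ → ℤ
stepIntegral F a b = if a ≤ᵇ b then sumN F a (b ∸ a) else - sumN F b (a ∸ b)

IsAdditionChain : (s : ℕ → ℕ) (d n : ℕ) → Set
IsAdditionChain s d n =
  (s 1 ≡ 1) × (s 2 ≡ 2) × (s (suc d) ≡ n) ×
  (∀ j → 3 ≤ j → j ≤ suc d →
     ∃₂ λ p q → 1 ≤ p × p < j × 1 ≤ q × q < j × s j ≡ s p + s q)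

AreGenerators : (s a r : ℕ → ℕ) (d : ℕ) → Set
AreGenerators s a r d =
  (a 2 ≡ 1) × (r 2 ≡ 1) ×
  (∀ i → 2 ≤ i → i ≤ suc d → s i ≡ a i + r i) ×
  (∀ i → 2 ≤ i → i ≤ d → a (suc i) ≡ a i + r i)

module Submission where

-- Write R(u) = r₂ + ⋯ + r_{u+1} for the partial sums of the
-- regulators (so R(0) = 0 and R(u) is the step function Σ_{2≤j≤t} r_j at
-- t = u+1).  The recurrence a₂ = 1, a_{i+1} = a_i + r_i telescopes to
-- a_{u+2} = 1 + R(u), hence
--   Σ_{j=2}^{d+1} a_j = d + R(0) + R(1) + ⋯ + R(d-1).
-- On the other side n = a_{d+1} + r_{d+1} = 1 + R(d-1) + r_{d+1},
-- a_d = 1 + R(d-2), and since the step function vanishes below 2 the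
-- integral ∫₂^{d-1} equals R(0) + ⋯ + R(d-3).  Substituting these three
-- values turns the claim into a ring identity.

open import Defs
open import Data.Nat using (ℕ; suc; _≤_; _∸_)
open import Data.Integer using (ℤ; +_) renaming (_+_ to _+ℤ_; _-_ to _-ℤ_)
open import Relation.Binary.PropositionalEquality using (_≡_)

open import Data.Nat using (zero; _+_; _<_; z≤n; s≤s)
open import Data.Nat.Properties using (+-suc; ≤-refl; ≤-trans; n≤1+n; ≤⇒≯)
  renaming (+-identityʳ to +-identityʳ-ℕ)
open import Data.Integer.Properties using (+-assoc; +-identityˡ; +-identityʳ)
open import Data.Integer.Solver using (module +-*-Solver)
open import Data.Empty using (⊥-elim)
open import Data.Product using (_,_; proj₁; proj₂)
open import Relation.Binary.PropositionalEquality
  using (refl; sym; trans; cong; module ≡-Reasoning)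

open +-*-Solver using (solve; _:+_; _:-_; _:=_; con)

sumN-snoc : ∀ (f : ℕ → ℤ) a l → sumN f a (suc l) ≡ sumN f a l +ℤ f (a + l)
sumN-snoc f a zero rewrite +-identityʳ-ℕ a = trans (+-identityʳ (f a)) (sym (+-identityˡ (f a)))
sumN-snoc f a (suc l) rewrite +-suc a l =
  trans (cong (f a +ℤ_) (sumN-snoc f (suc a) l)) (sym (+-assoc (f a) _ _))

sumN-shift : ∀ (f : ℕ → ℤ) a l → sumN f (suc a) l ≡ sumN (λ u → f (suc u)) a l
sumN-shift f a zero    = refl
sumN-shift f a (suc l) = cong (f (suc a) +ℤ_) (sumN-shift f (suc a) l)

-- R(u) = r₂ + ⋯ + r_{u+1}; definitionally this is stepSum r (u + 1).
regulatorSum : (ℕ → ℕ) → ℕ → ℤ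
regulatorSum r u = sumN (λ j → + r j) 2 u

-- The integral of the step function from 2 to m is R(0) + ⋯ + R(m-2),
-- for every m: below t = 2 the step function is 0, so the oriented
-- integral in the degenerate cases m ≤ 1 vanishes as well.
stepIntegral-stepSum : ∀ r m →
  stepIntegral (stepSum r) 2 m ≡ sumN (regulatorSum r) 0 (m ∸ 1)
stepIntegral-stepSum r zero          = refl
stepIntegral-stepSum r (suc zero)    = refl
stepIntegral-stepSum r (suc (suc f)) =
  trans (sumN-shift (stepSum r) 1 f) (sym (+-identityˡ _))

module Generators {s a r : ℕ → ℕ} {d : ℕ} (gen : AreGenerators s a r d) where

  a₂≡1 : a 2 ≡ 1
  a₂≡1 = proj₁ gen

  generator : ∀ i → 2 ≤ i → i ≤ suc d → s i ≡ a i + r i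
  generator = proj₁ (proj₂ (proj₂ gen))

  recurrence : ∀ i → 2 ≤ i → i ≤ d → a (suc i) ≡ a i + r i
  recurrence = proj₂ (proj₂ (proj₂ gen))

  determiner-value : ∀ u → u < d → + a (suc (suc u)) ≡ + 1 +ℤ regulatorSum r u
  determiner-value zero    _          = cong +_ a₂≡1
  determiner-value (suc u) u<d = begin
    + a (3 + u)                                    ≡⟨ cong +_ (recurrence (2 + u) (s≤s (s≤s z≤n)) u<d) ⟩
    + a (2 + u) +ℤ + r (2 + u)                     ≡⟨ cong (_+ℤ + r (2 + u)) (determiner-value u (≤-trans (n≤1+n _) u<d)) ⟩
    (+ 1 +ℤ regulatorSum r u) +ℤ + r (2 + u)        ≡⟨ +-assoc (+ 1) (regulatorSum r u) (+ r (2 + u)) ⟩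
    + 1 +ℤ (regulatorSum r u +ℤ + r (2 + u))        ≡⟨ cong (+ 1 +ℤ_) (sym (sumN-snoc (λ j → + r j) 2 u)) ⟩
    + 1 +ℤ regulatorSum r (suc u)                   ∎
    where open ≡-Reasoning

  determiner-sum : ∀ m → m ≤ d →
    sumN (λ j → + a j) 2 m ≡ + m +ℤ sumN (regulatorSum r) 0 m
  determiner-sum zero    _   = refl
  determiner-sum (suc m) m<d = begin
    sumN A 2 (suc m)                            ≡⟨ sumN-snoc A 2 m ⟩
    sumN A 2 m +ℤ A (2 + m)                      ≡⟨ cong (_+ℤ A (2 + m)) (determiner-sum m (≤-trans (n≤1+n m) m<d)) ⟩
    (+ m +ℤ sumN R 0 m) +ℤ A (2 + m)             ≡⟨ cong ((+ m +ℤ sumN R 0 m) +ℤ_) (determiner-value m m<d) ⟩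
    (+ m +ℤ sumN R 0 m) +ℤ (+ 1 +ℤ R m)          ≡⟨ regroup (+ m) (sumN R 0 m) (R m) ⟩
    + suc m +ℤ (sumN R 0 m +ℤ R m)               ≡⟨ cong (+ suc m +ℤ_) (sym (sumN-snoc R 0 m)) ⟩
    + suc m +ℤ sumN R 0 (suc m)                  ∎
    where
    open ≡-Reasoning
    A : ℕ → ℤ
    A j = + a j
    R : ℕ → ℤ
    R = regulatorSum r
    regroup : ∀ x y z → (x +ℤ y) +ℤ (+ 1 +ℤ z) ≡ (+ 1 +ℤ x) +ℤ (y +ℤ z)
    regroup = solve 3 (λ x y z → (x :+ y) :+ (con (+ 1) :+ z) := (con (+ 1) :+ x) :+ (y :+ z)) refl

  last-term-value : ∀ e → d ≡ suc e → + s (suc d) ≡ (+ 1 +ℤ regulatorSum r e) +ℤ + r (suc d)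
  last-term-value e refl =
    trans (cong +_ (generator (suc d) (s≤s (s≤s z≤n)) ≤-refl))
          (cong (_+ℤ + r (suc d)) (determiner-value e ≤-refl))

-- A chain of length 0 or 1 is 1 or 1, 2, so it produces n ≤ 2.
short-chain-target : ∀ {s n d} → IsAdditionChain s d n → d ≤ 1 → n ≤ 2
short-chain-target {d = zero}  (s₁ , _ , sₙ , _) _ rewrite trans (sym sₙ) s₁ = s≤s z≤n
short-chain-target {d = suc zero} (_ , s₂ , sₙ , _) _ rewrite trans (sym sₙ) s₂ = ≤-refl
short-chain-target {d = suc (suc _)} _ (s≤s ())

theorem2p6 : (n d : ℕ) (s a r : ℕ → ℕ) → 3 ≤ n →
    IsAdditionChain s d n → AreGenerators s a r d →
    sumFT (λ j → + a j) 2 (suc d)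
    ≡ (((+ n -ℤ + 1) +ℤ (+ d -ℤ + 1)) +ℤ + a d) -ℤ + r (suc d)
    +ℤ stepIntegral (stepSum r) 2 (d ∸ 1)
theorem2p6 n zero          s a r 3≤n chain _ = ⊥-elim (≤⇒≯ (short-chain-target chain z≤n) 3≤n)
theorem2p6 n (suc zero)    s a r 3≤n chain _ = ⊥-elim (≤⇒≯ (short-chain-target chain ≤-refl) 3≤n)
theorem2p6 n (suc (suc e)) s a r _ (_ , _ , sₙ , _) gen = begin
  sumN (λ j → + a j) 2 d                                  ≡⟨ determiner-sum d ≤-refl ⟩
  + d +ℤ sumN R 0 (2 + e)                                 ≡⟨ cong (+ d +ℤ_) (trans (sumN-snoc R 0 (suc e)) (cong (_+ℤ R (suc e)) (sumN-snoc R 0 e))) ⟩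
  + d +ℤ ((sumN R 0 e +ℤ R e) +ℤ R (suc e))               ≡⟨ rearrange (+ e) (sumN R 0 e) (R e) (R (suc e)) (+ r (suc d)) ⟩
  rhs ((+ 1 +ℤ R (suc e)) +ℤ + r (suc d)) (+ 1 +ℤ R e) (sumN R 0 e)
    ≡⟨ cong (λ N → rhs N (+ 1 +ℤ R e) (sumN R 0 e)) (trans (sym (last-term-value (suc e) refl)) (cong +_ sₙ)) ⟩
  rhs (+ n) (+ 1 +ℤ R e) (sumN R 0 e)                      ≡⟨ cong (λ A → rhs (+ n) A (sumN R 0 e)) (sym (determiner-value e (n≤1+n _))) ⟩
  rhs (+ n) (+ a d) (sumN R 0 e)                           ≡⟨ cong (rhs (+ n) (+ a d)) (sym (stepIntegral-stepSum r (suc e))) ⟩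
  rhs (+ n) (+ a d) (stepIntegral (stepSum r) 2 (d ∸ 1))   ∎
  where
  open ≡-Reasoning
  open Generators {s} {a} {r} {suc (suc e)} gen
  d : ℕ
  d = suc (suc e)
  R : ℕ → ℤ
  R = regulatorSum r
  rhs : ℤ → ℤ → ℤ → ℤ
  rhs N A I = (((N -ℤ + 1) +ℤ (+ d -ℤ + 1)) +ℤ A) -ℤ + r (suc d) +ℤ I
  -- With t = d - 2, i = R(0)+⋯+R(d-3), x = R(d-2), y = R(d-1), q = r_{d+1},
  -- the claim after substitution is this ring identity.
  rearrange : ∀ t i x y q → (+ 2 +ℤ t) +ℤ ((i +ℤ x) +ℤ y)
    ≡ ((((+ 1 +ℤ y) +ℤ q) -ℤ + 1) +ℤ ((+ 2 +ℤ t) -ℤ + 1) +ℤ (+ 1 +ℤ x)) -ℤ q +ℤ i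
  rearrange = solve 5 (λ t i x y q → (con (+ 2) :+ t) :+ ((i :+ x) :+ y)
    := ((((con (+ 1) :+ y) :+ q) :- con (+ 1)) :+ ((con (+ 2) :+ t) :- con (+ 1)) :+ (con (+ 1) :+ x)) :- q :+ i) refl
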